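{- Let $x\ge1$ and let $\sigma=\lambda\setminus\mu_x$ be a strict skew Ferrers diagram of reduced dimension $x$ with $m=|\sigma|$ nodes. If its density $m/x$ lies in the open interval $(\tfrac12,\tfrac23)$, then $\sigma$ is reducible, and among its components there are at least $n\ge 2x-3m$ components each isomorphic to $\sigma_2$, i.e. $\sigma$ has a component of the form $(\sigma_2)^n$ with $n\ge 2x-3m$.
   Context: A Ferrers diagram (FD) in $\mathbb{Z}_{\ge0}^{k}$ is a finite set $\lambda\subset\mathbb{Z}_{\ge0}^k$ (elements called nodes) such that if $\mathbf a\in\lambda$ and $0\le \mathbf x\le\mathbf a$ componentwise then $\mathbf x\in\lambda$. Let $\mu_x=\{0,e_1,\dots,e_x\}\subset\mathbb{Z}_{\ge0}^x$. For an FD $\lambda\subset\mathbb{Z}_{\ge0}^x$ containing $\mu_x$, the skew FD $\sigma=\lambda\setminus\mu_x$ has reduced dimension (r.d.) equal to the number of coordinate indices $i$ such that some node of $\sigma$ has nonzero $i$-th coordinate; $\sigma$ is strict if its r.d. equals $x$. Its density is $|\sigma|/x$. The support of a node is the set of indices of its nonzero coordinates. $\sigma$ is reducible if there is a partition $\{1,\dots,x\}=S\sqcup T$ with $S,T$ nonempty and a nonempty proper subset $\sigma'\subsetneq\sigma$ such that every node of $\sigma'$ has support in $S$ and every node of $\sigma\setminus\sigma'$ has support in $T$; otherwise irreducible. The components of $\sigma$ are the pieces of its finest such decomposition (each piece lives on its own block of coordinates and is irreducible there). $\sigma_2$ denotes the irreducible strict skew FD on two coordinates $\{i,j\}$ consisting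 of the single node $e_i+e_j$; $(\sigma_2)^n$ denotes a union of $n$ such components on disjoint pairs of coordinates. -}

module Defs where

open import Data.Nat using (ℕ; zero; suc; _+_; _*_; _≤_; _<_)
open import Data.Fin using (Fin; _≟_)
import Data.Fin as F
open import Data.Fin.Subset using (Subset; _∈_; _∉_)
open import Data.Vec using (Vec; lookup; tabulate; replicate; zipWith)
open import Data.List using (List; length)
import Data.List.Membership.Propositional as LM
open import Data.List.Relation.Unary.Unique.Propositional using (Unique)
open import Data.Product using (Σ; ∃; _×_; _,_)
open import Data.Sum using (_⊎_)
open import Relation.Binary.PropositionalEquality using (_≡_; _≢_)
open import Relation.Nullary using (¬_; does)
open import Data.Bool using (Bool; true; false; if_then_else_)

Node : ℕ → Set
Node k = Vec ℕ k

_≤ᶜ_ : ∀ {k} → Node k → Node k → Set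
y ≤ᶜ a = ∀ i → lookup y i ≤ lookup a i

unit : ∀ {k} → Fin k → Node k
unit i = tabulate (λ j → if does (j ≟ i) then 1 else 0)

zeroNode : ∀ {k} → Node k
zeroNode = replicate _ 0

_⊕_ : ∀ {k} → Node k → Node k → Node k
_⊕_ = zipWith _+_

IsFD : ∀ {k} → List (Node k) → Set
IsFD {k} lam = Unique lam × (∀ a → a LM.∈ lam → ∀ y → y ≤ᶜ a → y LM.∈ lam)

InMu : ∀ {k} → Node k → Set
InMu a = a ≡ zeroNode ⊎ ∃ λ i → a ≡ unit i

ContainsMu : ∀ {k} → List (Node k) → Set
ContainsMu {k} lam = zeroNode {k} LM.∈ lam × (∀ (i : Fin k) → unit i LM.∈ lam)

IsSkew : ∀ {k} → List (Node k) → List (Node k) → Set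
IsSkew lam sig = Unique sig × (∀ a → (a LM.∈ sig → a LM.∈ lam × ¬ InMu a) × (a LM.∈ lam × ¬ InMu a → a LM.∈ sig))

SuppIn : ∀ {k} → Node k → Subset k → Set
SuppIn a S = ∀ i → lookup a i ≢ 0 → i ∈ S

-- strict: every coordinate index is used by some node (reduced dimension = k)
Strict : ∀ {k} → List (Node k) → Set
Strict {k} sig = ∀ (i : Fin k) → ∃ λ a → a LM.∈ sig × lookup a i ≢ 0

-- reducible: partition {1..k} = S ⊔ Sᶜ, both nonempty, and a nonempty proper
-- subset σ' (given by its characteristic function P) with supports of σ' in S
-- and supports of σ \ σ' in Sᶜ.
Reducible : ∀ {k} → List (Node k) → Set
Reducible {k} sig =
  Σ (Subset k) λ S → Σ (Node k → Bool) λ P →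
    (∃ λ i → i ∈ S) × (∃ λ i → i ∉ S) ×
    (∃ λ a → a LM.∈ sig × P a ≡ true) × (∃ λ a → a LM.∈ sig × P a ≡ false) ×
    (∀ a → a LM.∈ sig → P a ≡ true → SuppIn a S) ×
    (∀ a → a LM.∈ sig → P a ≡ false → ∀ i → lookup a i ≢ 0 → i ∉ S)

-- {e_i + e_j} (i ≠ j) is a component of σ isomorphic to σ₂: the node lies in σ
-- and splits off, i.e. every other node of σ has support in the complement of {i,j}.
Sigma2Component : ∀ {k} → List (Node k) → Fin k → Fin k → Set
Sigma2Component sig i j =
  (unit i ⊕ unit j) LM.∈ sig ×
  (∀ a → a LM.∈ sig → a ≢ (unit i ⊕ unit j) → lookup a i ≡ 0 × lookup a j ≡ 0)

-- Call the nodes of σ of size 2 (the e_i + e_j and the 2e_i) its edges, and a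
-- coordinate a leaf if exactly one edge touches it. A node of σ with nonzero i-th coordinate
-- lies above an edge touching i, by downward closure and σ ∩ μ = ∅; so every coordinate is
-- touched. An edge a sends 3 to a coordinate k with a_k = 2, and 2 or 1 to a coordinate k with
-- a_k = 1 according as k is a leaf or not. Every coordinate receives at least 2 (a leaf from its
-- edge, any other coordinate from two edges), and an edge sends at most 3 unless it is e_i + e_j
-- with both i and j leaves; such an edge is a σ₂-component, because another node touching i
-- or j would lie above a second edge at a leaf. Hence 2x ≤ 3m + n, so m/x < 2/3 gives n ≥ 1,
-- and with m/x > 1/2, hence m ≥ 2, that component splits σ.

module Submission where

open import Defs
open import Data.Bool using (Bool; true; false; if_then_else_)
open import Data.Fin using (Fin; zero; suc)
import Data.Fin as F
open import Data.Fin.Properties as FinP using () renaming (_≟_ to _≟ᶠ_)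
open import Data.Fin.Subset using (Subset; ⁅_⁆; _∪_) renaming (_∈_ to _∈ₛ_; _∉_ to _∉ₛ_)
open import Data.Fin.Subset.Properties using (x∈⁅x⁆; x∈⁅y⁆⇒x≡y; x∈p∪q⁺; x∈p∪q⁻)
open import Data.List using (List; []; _∷_; length; map; filter; cartesianProduct; allFin)
open import Data.List.Membership.Propositional using (_∈_)
open import Data.List.Membership.Propositional.Properties
  using (∈-filter⁺; ∈-filter⁻; ∈-map⁺; ∈-cartesianProduct⁺; ∈-allFin)
open import Data.List.Properties using (length-map; length-filter; length-removeAt′)
open import Data.List.Relation.Unary.Any using (here; there; index; _─_)
open import Data.List.Relation.Unary.All as All using (_∷_)
open import Data.List.Relation.Unary.Unique.Propositional using (Unique; _∷_)
import Data.List.Relation.Unary.Unique.Propositional.Properties as Unique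
open import Data.Nat using (ℕ; zero; suc; _+_; _*_; _≤_; _<_; z≤n; s≤s)
import Data.Nat.ListAction as ℕᴸ
open import Data.Nat.Properties
open import Algebra.Properties.CommutativeMonoid.Sum +-0-commutativeMonoid
  using (sum-syntax; ∑-distrib-+; sum-cong-≗; sum-replicate-zero)
open import Algebra.Properties.CommutativeSemigroup +-commutativeSemigroup using (interchange)
open import Data.Product using (Σ; ∃; ∃₂; _×_; _,_; proj₁; proj₂)
open import Data.Sum as Sum using (_⊎_; inj₁; inj₂)
open import Data.Vec using ([]; _∷_; lookup)
open import Data.Vec.Properties
  using (lookup∘tabulate; tabulate∘lookup; tabulate-cong; lookup-zipWith; lookup-replicate; ≡-dec; zipWith-identityˡ)
open import Function using (_∘_)
open import Relation.Binary.Definitions using (DecidableEquality)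
open import Relation.Binary.PropositionalEquality
open import Relation.Nullary using (¬_; Dec; yes; no; does; ¬?; _×-dec_; contradiction)
open import Relation.Nullary.Decidable using (dec-true; dec-false; decidable-stable)

-- Finite sums

∑-mono-≤ : ∀ {n} {f g : Fin n → ℕ} → (∀ k → f k ≤ g k) → ∑[ k < n ] f k ≤ ∑[ k < n ] g k
∑-mono-≤ {zero}  _   = z≤n
∑-mono-≤ {suc n} f≤g = +-mono-≤ (f≤g zero) (∑-mono-≤ (f≤g ∘ suc))

∑-const : ∀ n c → ∑[ _ < n ] c ≡ n * c
∑-const zero    c = refl
∑-const (suc n) c = cong (c +_) (∑-const n c)

∑-zero : ∀ {n} {f : Fin n → ℕ} → (∀ k → f k ≡ 0) → ∑[ k < n ] f k ≡ 0
∑-zero {n} f≡0 = trans (sum-cong-≗ f≡0) (sum-replicate-zero n)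

∑-support₁ : ∀ {n} (f : Fin n → ℕ) i → (∀ k → k ≢ i → f k ≡ 0) → ∑[ k < n ] f k ≡ f i
∑-support₁ f zero    f≡0 = trans (cong (f zero +_) (∑-zero (λ k → f≡0 (suc k) λ ()))) (+-identityʳ _)
∑-support₁ f (suc i) f≡0 rewrite f≡0 zero (λ ()) =
  ∑-support₁ (f ∘ suc) i (λ k k≢i → f≡0 (suc k) (k≢i ∘ FinP.suc-injective))

∑-support₂ : ∀ {n} (f : Fin n → ℕ) {i j} → i ≢ j → (∀ k → k ≢ i → k ≢ j → f k ≡ 0) →
             ∑[ k < n ] f k ≡ f i + f j
∑-support₂ f {zero}  {zero}  i≢j _   = contradiction refl i≢j
∑-support₂ f {zero}  {suc j} _   f≡0 =
  cong (f zero +_) (∑-support₁ (f ∘ suc) j (λ k k≢j → f≡0 (suc k) (λ ()) (k≢j ∘ FinP.suc-injective)))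
∑-support₂ f {suc i} {zero}  _   f≡0 =
  trans (cong (f zero +_) (∑-support₁ (f ∘ suc) i (λ k k≢i → f≡0 (suc k) (k≢i ∘ FinP.suc-injective) (λ ()))))
        (+-comm (f zero) _)
∑-support₂ f {suc i} {suc j} i≢j f≡0 rewrite f≡0 zero (λ ()) (λ ()) =
  ∑-support₂ (f ∘ suc) (i≢j ∘ cong suc)
    (λ k k≢i k≢j → f≡0 (suc k) (k≢i ∘ FinP.suc-injective) (k≢j ∘ FinP.suc-injective))

∑ᴸ : ∀ {A : Set} → List A → (A → ℕ) → ℕ
∑ᴸ xs f = ℕᴸ.sum (map f xs)

module _ {A : Set} where

  ∑ᴸ-mono-≤ : ∀ (xs : List A) {f g : A → ℕ} → (∀ {a} → a ∈ xs → f a ≤ g a) →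
              ∑ᴸ xs f ≤ ∑ᴸ xs g
  ∑ᴸ-mono-≤ []       _   = z≤n
  ∑ᴸ-mono-≤ (a ∷ xs) f≤g = +-mono-≤ (f≤g (here refl)) (∑ᴸ-mono-≤ xs (f≤g ∘ there))

  ∑ᴸ-distrib-+ : ∀ (xs : List A) (f g : A → ℕ) → ∑ᴸ xs (λ a → f a + g a) ≡ ∑ᴸ xs f + ∑ᴸ xs g
  ∑ᴸ-distrib-+ []       f g = refl
  ∑ᴸ-distrib-+ (a ∷ xs) f g rewrite ∑ᴸ-distrib-+ xs f g = interchange (f a) (g a) _ _

  ∑ᴸ-const : ∀ (xs : List A) c → ∑ᴸ xs (λ _ → c) ≡ length xs * c
  ∑ᴸ-const []       c = refl
  ∑ᴸ-const (a ∷ xs) c = cong (c +_) (∑ᴸ-const xs c)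

  ∈⇒≤∑ᴸ : ∀ (f : A → ℕ) {a xs} → a ∈ xs → f a ≤ ∑ᴸ xs f
  ∈⇒≤∑ᴸ f (here refl) = m≤m+n _ _
  ∈⇒≤∑ᴸ f {xs = b ∷ _} (there a∈) = ≤-trans (∈⇒≤∑ᴸ f a∈) (m≤n+m _ (f b))

  ∈₂⇒≤∑ᴸ : ∀ (f : A → ℕ) {a b xs} → a ∈ xs → b ∈ xs → a ≢ b → f a + f b ≤ ∑ᴸ xs f
  ∈₂⇒≤∑ᴸ f (here refl) (here refl) a≢b = contradiction refl a≢b
  ∈₂⇒≤∑ᴸ f (here refl) (there b∈)  _   = +-monoʳ-≤ (f _) (∈⇒≤∑ᴸ f b∈)
  ∈₂⇒≤∑ᴸ f {a} {b} {_ ∷ xs} (there a∈) (here refl) _ =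
    subst (_≤ f b + ∑ᴸ xs f) (+-comm (f b) (f a)) (+-monoʳ-≤ (f b) (∈⇒≤∑ᴸ f a∈))
  ∈₂⇒≤∑ᴸ f {xs = c ∷ _} (there a∈) (there b∈) a≢b =
    ≤-trans (∈₂⇒≤∑ᴸ f a∈ b∈ a≢b) (m≤n+m _ (f c))

  ∑-∑ᴸ-comm : ∀ {n} (xs : List A) (f : Fin n → A → ℕ) →
              ∑[ k < n ] ∑ᴸ xs (f k) ≡ ∑ᴸ xs (λ a → ∑[ k < n ] f k a)
  ∑-∑ᴸ-comm {n} []       f = sum-replicate-zero n
  ∑-∑ᴸ-comm     (a ∷ xs) f = trans (∑-distrib-+ (λ k → f k a) (λ k → ∑ᴸ xs (f k)))
                                   (cong (∑[ k < _ ] f k a +_) (∑-∑ᴸ-comm xs f))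

-- Lists without repetition

module _ {A : Set} where

  ∈-─ : ∀ {a b : A} {ys} (b∈ : b ∈ ys) → a ∈ ys → a ≢ b → a ∈ (ys ─ b∈)
  ∈-─ (here refl) (here refl) a≢b = contradiction refl a≢b
  ∈-─ (here refl) (there a∈)  _   = a∈
  ∈-─ (there b∈)  (here refl) _   = here refl
  ∈-─ (there b∈)  (there a∈)  a≢b = there (∈-─ b∈ a∈ a≢b)

  Unique⇒length≤ : ∀ {xs ys : List A} → Unique xs → (∀ {a} → a ∈ xs → a ∈ ys) → length xs ≤ length ys
  Unique⇒length≤ {[]}     _             _   = z≤n
  Unique⇒length≤ {a ∷ xs} {ys} (a∉ ∷ xs!) xs⊆ys =
    subst (suc (length xs) ≤_) (sym (length-removeAt′ ys (index a∈ys)))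
      (s≤s (Unique⇒length≤ xs! λ b∈xs → ∈-─ a∈ys (xs⊆ys (there b∈xs)) (All.lookup a∉ b∈xs ∘ sym)))
    where a∈ys = xs⊆ys (here refl)

  length≡1⇒≡ : ∀ {xs : List A} {a b} → length xs ≡ 1 → a ∈ xs → b ∈ xs → a ≡ b
  length≡1⇒≡ {_ ∷ []} _ (here refl) (here refl) = refl

  ∈⇒0<length : ∀ {xs : List A} {a} → a ∈ xs → 0 < length xs
  ∈⇒0<length (here _)  = s≤s z≤n
  ∈⇒0<length (there _) = s≤s z≤n

  0<length⇒∈ : ∀ {xs : List A} → 0 < length xs → ∃ λ a → a ∈ xs
  0<length⇒∈ {a ∷ _} _ = a , here refl

  ∃-other : DecidableEquality A → ∀ {xs : List A} → Unique xs → 2 ≤ length xs →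
            ∀ c → ∃ λ a → a ∈ xs × a ≢ c
  ∃-other _≟ₐ_ {a ∷ b ∷ _} ((a≢b ∷ _) ∷ _) (s≤s (s≤s z≤n)) c with a ≟ₐ c
  ... | yes refl = b , there (here refl) , a≢b ∘ sym
  ... | no a≢c   = a , here refl , a≢c

𝟙 : ∀ {P : Set} → Dec P → ℕ
𝟙 (yes _) = 1
𝟙 (no _)  = 0

𝟙-yes : ∀ {P : Set} (p? : Dec P) → P → 1 ≤ 𝟙 p?
𝟙-yes (yes _) _ = s≤s z≤n
𝟙-yes (no ¬p) p = contradiction p ¬p

module _ {A : Set} {P : A → Set} (P? : ∀ a → Dec (P a)) where

  ∑ᴸ-𝟙 : ∀ xs → ∑ᴸ xs (𝟙 ∘ P?) ≡ length (filter P? xs)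
  ∑ᴸ-𝟙 []       = refl
  ∑ᴸ-𝟙 (a ∷ xs) with P? a
  ... | yes _ = cong suc (∑ᴸ-𝟙 xs)
  ... | no  _ = ∑ᴸ-𝟙 xs

  ∑ᴸ-𝟙≤length : ∀ {xs ys} → Unique xs → (∀ {a} → P a → a ∈ ys) →
                 ∑ᴸ xs (𝟙 ∘ P?) ≤ length ys
  ∑ᴸ-𝟙≤length {xs} xs! P⊆ys = subst (_≤ _) (sym (∑ᴸ-𝟙 xs))
    (Unique⇒length≤ (Unique.filter⁺ P? xs!) (P⊆ys ∘ proj₂ ∘ ∈-filter⁻ P? {xs = xs}))

-- Nodes

module _ {n : ℕ} where

  _≟ᵥ_ : DecidableEquality (Node n)
  _≟ᵥ_ = ≡-dec _≟_

  Node-ext : ∀ {a b : Node n} → (∀ k → lookup a k ≡ lookup b k) → a ≡ b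
  Node-ext {a} {b} a≗b = trans (sym (tabulate∘lookup a)) (trans (tabulate-cong a≗b) (tabulate∘lookup b))

  ≢zeroNode⇒∃≢0 : ∀ {a : Node n} → a ≢ zeroNode → ∃ λ k → lookup a k ≢ 0
  ≢zeroNode⇒∃≢0 {a} a≢0 with FinP.any? (λ k → ¬? (lookup a k ≟ 0))
  ... | yes k,ak≢0 = k,ak≢0
  ... | no  ∄      = contradiction (Node-ext λ k → trans (decidable-stable (lookup a k ≟ 0) (∄ ∘ (k ,_)))
                                                      (sym (lookup-replicate k 0)))
                                   a≢0

  ≤ᶜ∧≢⇒∃< : ∀ {a b : Node n} → a ≤ᶜ b → a ≢ b → ∃ λ k → lookup a k < lookup b k
  ≤ᶜ∧≢⇒∃< {a} {b} a≤b a≢b with FinP.any? (λ k → ¬? (lookup a k ≟ lookup b k))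
  ... | yes (k , ak≢bk) = k , ≤∧≢⇒< (a≤b k) ak≢bk
  ... | no  ∄           =
    contradiction (Node-ext λ k → decidable-stable (lookup a k ≟ lookup b k) (∄ ∘ (k ,_))) a≢b

  lookup-unit-≡ : ∀ i → lookup (unit {n} i) i ≡ 1
  lookup-unit-≡ i =
    trans (lookup∘tabulate _ i) (cong (λ b → if b then 1 else 0) (dec-true (i ≟ᶠ i) refl))

  lookup-unit-≢ : ∀ {i k} → k ≢ i → lookup (unit {n} i) k ≡ 0
  lookup-unit-≢ {i} {k} k≢i =
    trans (lookup∘tabulate _ k) (cong (λ b → if b then 1 else 0) (dec-false (k ≟ᶠ i) k≢i))

  pair : Fin n → Fin n → Node n
  pair i j = unit i ⊕ unit j

  lookup-pair : ∀ i j k → lookup (pair i j) k ≡ lookup (unit i) k + lookup (unit j) k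
  lookup-pair i j k = lookup-zipWith _+_ k (unit i) (unit j)

  pair-comm : ∀ i j → pair i j ≡ pair j i
  pair-comm i j = Node-ext λ k →
    trans (lookup-pair i j k) (trans (+-comm (lookup (unit i) k) _) (sym (lookup-pair j i k)))

  lookup-pair-diag : ∀ i → lookup (pair i i) i ≡ 2
  lookup-pair-diag i rewrite lookup-pair i i i | lookup-unit-≡ i = refl

  lookup-pair-fst : ∀ {i j} → i ≢ j → lookup (pair i j) i ≡ 1
  lookup-pair-fst {i} {j} i≢j rewrite lookup-pair i j i | lookup-unit-≡ i | lookup-unit-≢ i≢j = refl

  lookup-pair-snd : ∀ {i j} → i ≢ j → lookup (pair i j) j ≡ 1
  lookup-pair-snd {i} {j} i≢j = trans (cong (λ c → lookup c j) (pair-comm i j)) (lookup-pair-fst (i≢j ∘ sym))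

  lookup-pair-≢ : ∀ {i j k} → k ≢ i → k ≢ j → lookup (pair i j) k ≡ 0
  lookup-pair-≢ {i} {j} {k} k≢i k≢j rewrite lookup-pair i j k | lookup-unit-≢ k≢i | lookup-unit-≢ k≢j = refl

  lookup-pair-fst-≢0 : ∀ i j → lookup (pair i j) i ≢ 0
  lookup-pair-fst-≢0 i j rewrite lookup-pair i j i | lookup-unit-≡ i = λ ()

  lookup-pair-snd-≢0 : ∀ i j → lookup (pair i j) j ≢ 0
  lookup-pair-snd-≢0 i j rewrite pair-comm i j = lookup-pair-fst-≢0 j i

  pair-support : ∀ {i j k} → lookup (pair i j) k ≢ 0 → k ≡ i ⊎ k ≡ j
  pair-support {i} {j} {k} pk≢0 with k ≟ᶠ i | k ≟ᶠ j
  ... | yes k≡i | _        = inj₁ k≡i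
  ... | no  _   | yes k≡j  = inj₂ k≡j
  ... | no  k≢i | no  k≢j  = contradiction (lookup-pair-≢ k≢i k≢j) pk≢0

  pair-diag≢pair : ∀ {i j} → i ≢ j → pair i i ≢ pair i j
  pair-diag≢pair {i} {j} i≢j e
    with trans (sym (lookup-pair-diag i)) (trans (cong (λ c → lookup c i) e) (lookup-pair-fst i≢j))
  ... | ()

  pair≢pair : ∀ {i j p} → p ≢ i → p ≢ j → pair i p ≢ pair i j
  pair≢pair {i} {j} {p} p≢i p≢j e =
    lookup-pair-snd-≢0 i p (trans (cong (λ c → lookup c p) e) (lookup-pair-≢ p≢i p≢j))

  pair-diag-≤ᶜ : ∀ {i} {a : Node n} → 2 ≤ lookup a i → pair i i ≤ᶜ a
  pair-diag-≤ᶜ {i} {a} 2≤ai k with k ≟ᶠ i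
  ... | yes refl = subst (_≤ lookup a k) (sym (lookup-pair-diag k)) 2≤ai
  ... | no  k≢i  = subst (_≤ lookup a k) (sym (lookup-pair-≢ k≢i k≢i)) z≤n

  pair-≤ᶜ : ∀ {i j} {a : Node n} → i ≢ j → 1 ≤ lookup a i → 1 ≤ lookup a j → pair i j ≤ᶜ a
  pair-≤ᶜ {i} {j} {a} i≢j 1≤ai 1≤aj k with k ≟ᶠ i | k ≟ᶠ j
  ... | yes refl | _        = subst (_≤ lookup a k) (sym (lookup-pair-fst i≢j)) 1≤ai
  ... | no  _    | yes refl = subst (_≤ lookup a k) (sym (lookup-pair-snd i≢j)) 1≤aj
  ... | no  k≢i  | no  k≢j  = subst (_≤ lookup a k) (sym (lookup-pair-≢ k≢i k≢j)) z≤n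

  size : Node n → ℕ
  size a = ∑[ k < n ] lookup a k

  size-zeroNode : size (zeroNode {n}) ≡ 0
  size-zeroNode = ∑-zero {n} {lookup zeroNode} (λ k → lookup-replicate k 0)

  size-unit : ∀ i → size (unit i) ≡ 1
  size-unit i = trans (∑-support₁ _ i (λ _ → lookup-unit-≢)) (lookup-unit-≡ i)

  size-pair : ∀ i j → size (pair i j) ≡ 2
  size-pair i j = begin
    size (pair i j)                     ≡⟨ sum-cong-≗ (lookup-pair i j) ⟩
    ∑[ k < n ] (lookup (unit i) k + lookup (unit j) k) ≡⟨ ∑-distrib-+ (lookup (unit i)) (lookup (unit j)) ⟩
    size (unit i) + size (unit j)       ≡⟨ cong₂ _+_ (size-unit i) (size-unit j) ⟩
    2                                   ∎
    where open ≡-Reasoning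

  pair∉μ : ∀ i j → ¬ InMu (pair i j)
  pair∉μ i j (inj₁ e)       with trans (sym (size-pair i j)) (trans (cong size e) size-zeroNode)
  ... | ()
  pair∉μ i j (inj₂ (k , e)) with trans (sym (size-pair i j)) (trans (cong size e) (size-unit k))
  ... | ()

unit-zero : ∀ {n} → unit {suc n} zero ≡ 1 ∷ zeroNode
unit-zero = Node-ext λ where
  zero    → refl
  (suc k) → trans (lookup-unit-≢ {i = zero} {k = suc k} λ ()) (sym (lookup-replicate k 0))

size≡0 : ∀ {n} (a : Node n) → size a ≡ 0 → a ≡ zeroNode
size≡0 []           _  = refl
size≡0 (zero ∷ a)   eq = cong (0 ∷_) (size≡0 a eq)

size≡1 : ∀ {n} (a : Node n) → size a ≡ 1 → ∃ λ i → a ≡ unit i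
size≡1 (zero ∷ a)     eq with size≡1 a eq
... | i , refl = suc i , refl
size≡1 (suc zero ∷ a) eq = zero , trans (cong (1 ∷_) (size≡0 a (suc-injective eq))) (sym unit-zero)

size≡2 : ∀ {n} (a : Node n) → size a ≡ 2 →
         (∃ λ i → a ≡ pair i i) ⊎ (∃₂ λ i j → i F.< j × a ≡ pair i j)
size≡2 (zero ∷ a) eq with size≡2 a eq
... | inj₁ (i , refl)           = inj₁ (suc i , refl)
... | inj₂ (i , j , i<j , refl) = inj₂ (suc i , suc j , s≤s i<j , refl)
size≡2 (suc zero ∷ a) eq with size≡1 a (suc-injective eq)
... | j , refl = inj₂ (zero , suc j , s≤s z≤n , sym (begin
  unit zero ⊕ unit (suc j)   ≡⟨ cong (_⊕ unit (suc j)) unit-zero ⟩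
  1 ∷ (zeroNode ⊕ unit j)    ≡⟨ cong (1 ∷_) (zipWith-identityˡ +-identityˡ (unit j)) ⟩
  1 ∷ unit j                 ∎))
  where open ≡-Reasoning
size≡2 (suc (suc zero) ∷ a) eq = inj₁ (zero , (begin
  2 ∷ a                      ≡⟨ cong (2 ∷_) (size≡0 a (suc-injective (suc-injective eq))) ⟩
  2 ∷ zeroNode               ≡⟨ cong (2 ∷_) (sym (zipWith-identityˡ +-identityˡ zeroNode)) ⟩
  (1 ∷ zeroNode) ⊕ (1 ∷ zeroNode) ≡⟨ sym (cong₂ _⊕_ unit-zero unit-zero) ⟩
  pair zero zero             ∎))
  where open ≡-Reasoning

σ₂-component⇒Reducible : ∀ {n} {sig : List (Node n)} {i j a k} → Sigma2Component sig i j →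
                         a ∈ sig → a ≢ pair i j → lookup a k ≢ 0 → Reducible sig
σ₂-component⇒Reducible {n} {sig} {i} {j} {a} {k} (c∈ , others) a∈ a≢c ak≢0 =
  S , isC , (i , x∈p∪q⁺ (inj₁ (x∈⁅x⁆ i))) , (k , avoids-S a∈ a≢c k ak≢0) ,
  (pair i j , c∈ , dec-true (pair i j ≟ᵥ pair i j) refl) , (a , a∈ , dec-false (a ≟ᵥ pair i j) a≢c) ,
  isC⇒SuppIn , ¬isC⇒avoids-S
  where
  S : Subset n
  S = ⁅ i ⁆ ∪ ⁅ j ⁆

  isC : Node n → Bool
  isC b = does (b ≟ᵥ pair i j)

  avoids-S : ∀ {b} → b ∈ sig → b ≢ pair i j → ∀ r → lookup b r ≢ 0 → r ∉ₛ S
  avoids-S b∈ b≢c r br≢0 r∈S with x∈p∪q⁻ ⁅ i ⁆ ⁅ j ⁆ r∈S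
  ... | inj₁ r∈⁅i⁆ rewrite x∈⁅y⁆⇒x≡y i r∈⁅i⁆ = br≢0 (proj₁ (others _ b∈ b≢c))
  ... | inj₂ r∈⁅j⁆ rewrite x∈⁅y⁆⇒x≡y j r∈⁅j⁆ = br≢0 (proj₂ (others _ b∈ b≢c))

  isC⇒SuppIn : ∀ b → b ∈ sig → isC b ≡ true → SuppIn b S
  isC⇒SuppIn b _ isC≡true with b ≟ᵥ pair i j
  isC⇒SuppIn b _ ()       | no _
  ... | yes refl = λ r pr≢0 → x∈p∪q⁺ (Sum.map (λ r≡i → subst (_∈ₛ ⁅ i ⁆) (sym r≡i) (x∈⁅x⁆ i))
                                               (λ r≡j → subst (_∈ₛ ⁅ j ⁆) (sym r≡j) (x∈⁅x⁆ j))
                                               (pair-support pr≢0))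

  ¬isC⇒avoids-S : ∀ b → b ∈ sig → isC b ≡ false → ∀ r → lookup b r ≢ 0 → r ∉ₛ S
  ¬isC⇒avoids-S b b∈ isC≡false with b ≟ᵥ pair i j
  ¬isC⇒avoids-S b b∈ ()        | yes _
  ... | no b≢c = avoids-S b∈ b≢c

-- Discharging

charge : ℕ → Bool → ℕ
charge zero          _     = 0
charge (suc zero)    true  = 2
charge (suc zero)    false = 1
charge (suc (suc _)) _     = 3

charge-≥1 : ∀ {v} b → v ≢ 0 → 1 ≤ charge v b
charge-≥1 {zero}        _     v≢0 = contradiction refl v≢0
charge-≥1 {suc zero}    true  _   = s≤s z≤n
charge-≥1 {suc zero}    false _   = s≤s z≤n
charge-≥1 {suc (suc _)} _     _   = s≤s z≤n

charge-≥2 : ∀ {v} → v ≢ 0 → 2 ≤ charge v true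
charge-≥2 {zero}        v≢0 = contradiction refl v≢0
charge-≥2 {suc zero}    _   = s≤s (s≤s z≤n)
charge-≥2 {suc (suc _)} _   = s≤s (s≤s z≤n)

charge-pair≤ : ∀ {P Q : Set} {m} (p : Dec P) (q : Dec Q) → (P → Q → 1 ≤ m) →
               charge 1 (does p) + charge 1 (does q) ≤ 3 + m
charge-pair≤ (yes p) (yes q) 1≤m = +-monoʳ-≤ 3 (1≤m p q)
charge-pair≤ (yes _) (no _)  _   = m≤m+n 3 _
charge-pair≤ (no _)  (yes _) _   = m≤m+n 3 _
charge-pair≤ (no _)  (no _)  _   = ≤-trans (s≤s (s≤s z≤n)) (m≤m+n 3 _)

module _ {n} (ℓ : Fin n → Bool) where

  ∑-charge-pair-diag : ∀ i → ∑[ k < n ] charge (lookup (pair i i) k) (ℓ k) ≡ 3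
  ∑-charge-pair-diag i =
    trans (∑-support₁ _ i (λ k k≢i → cong (λ v → charge v (ℓ k)) (lookup-pair-≢ k≢i k≢i)))
          (cong (λ v → charge v (ℓ i)) (lookup-pair-diag i))

  ∑-charge-pair : ∀ {i j} → i ≢ j →
                  ∑[ k < n ] charge (lookup (pair i j) k) (ℓ k) ≡ charge 1 (ℓ i) + charge 1 (ℓ j)
  ∑-charge-pair i≢j =
    trans (∑-support₂ _ i≢j (λ k k≢i k≢j → cong (λ v → charge v (ℓ k)) (lookup-pair-≢ k≢i k≢j)))
          (cong₂ _+_ (cong (λ v → charge v (ℓ _)) (lookup-pair-fst i≢j))
                     (cong (λ v → charge v (ℓ _)) (lookup-pair-snd i≢j)))

module Discharging {x} {lam sig : List (Node x)} (fd : IsFD lam) (sk : IsSkew lam sig) (strict : Strict sig) where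

  open import Data.List.Membership.DecPropositional (_≟ᵥ_ {x}) using (_∈?_)

  edges : List (Node x)
  edges = filter (λ a → size a ≟ 2) sig

  edgesAt : Fin x → List (Node x)
  edgesAt k = filter (λ a → ¬? (lookup a k ≟ 0)) edges

  Leaf : Fin x → Set
  Leaf k = length (edgesAt k) ≡ 1

  leaf? : ∀ k → Dec (Leaf k)
  leaf? k = length (edgesAt k) ≟ 1

  chargeTo : Fin x → Node x → ℕ
  chargeTo k a = charge (lookup a k) (does (leaf? k))

  edges-unique : Unique edges
  edges-unique = Unique.filter⁺ _ (proj₁ sk)

  edgesAt-unique : ∀ k → Unique (edgesAt k)
  edgesAt-unique k = Unique.filter⁺ _ edges-unique

  edgesAt⁻ : ∀ {k u} → u ∈ edgesAt k → u ∈ edges × lookup u k ≢ 0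
  edgesAt⁻ = ∈-filter⁻ _ {xs = edges}

  pair-∈-edgesAt : ∀ {i j} → pair i j ∈ sig → pair i j ∈ edgesAt i
  pair-∈-edgesAt {i} {j} p∈ = ∈-filter⁺ _ (∈-filter⁺ _ p∈ (size-pair i j)) (lookup-pair-fst-≢0 i j)

  σ∉μ : ∀ {a} → a ∈ sig → ¬ InMu a
  σ∉μ a∈ = proj₂ (proj₁ (proj₂ sk _) a∈)

  pair-below-∈σ : ∀ {a i j} → a ∈ sig → pair i j ≤ᶜ a → pair i j ∈ sig
  pair-below-∈σ a∈ p≤a =
    proj₂ (proj₂ sk _) (proj₂ fd _ (proj₁ (proj₁ (proj₂ sk _) a∈)) _ p≤a , pair∉μ _ _)

  ∃pair-below : ∀ {a i} → a ∈ sig → lookup a i ≢ 0 → ∃ λ l → pair i l ≤ᶜ a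
  ∃pair-below {a} {i} a∈ ai≢0 with 2 ≤? lookup a i
  ... | yes 2≤ai = i , pair-diag-≤ᶜ {a = a} 2≤ai
  ... | no  2≰ai with FinP.any? (λ l → ¬? (l ≟ᶠ i) ×-dec ¬? (lookup a l ≟ 0))
  ...   | yes (l , l≢i , al≢0) = l , pair-≤ᶜ {a = a} (l≢i ∘ sym) (n≢0⇒n>0 ai≢0) (n≢0⇒n>0 al≢0)
  ...   | no  ∄ = contradiction (inj₂ (size≡1 a size-a≡1)) (σ∉μ a∈)
    where
    size-a≡1 : size a ≡ 1
    size-a≡1 = trans (∑-support₁ (lookup a) i λ l l≢i →
                        decidable-stable (lookup a l ≟ 0) (∄ ∘ (l ,_) ∘ (l≢i ,_)))
                     (≤-antisym (≤-pred (≰⇒> 2≰ai)) (n≢0⇒n>0 ai≢0))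

  edgesAt-nonempty : ∀ k → ∃ λ u → u ∈ edgesAt k
  edgesAt-nonempty k with strict k
  ... | a , a∈ , ak≢0 with ∃pair-below a∈ ak≢0
  ...   | l , p≤a = pair k l , pair-∈-edgesAt (pair-below-∈σ a∈ p≤a)

  received : ∀ k → 2 ≤ ∑ᴸ edges (chargeTo k)
  received k = via (proj₂ (edgesAt-nonempty k))
    where
    via : ∀ {u} → u ∈ edgesAt k → 2 ≤ ∑ᴸ edges (chargeTo k)
    via {u} u∈ with edgesAt⁻ u∈ | leaf? k
    ... | u∈edges , uk≢0 | yes leaf =
      ≤-trans (subst (λ b → 2 ≤ charge (lookup u k) b) (sym (dec-true (leaf? k) leaf)) (charge-≥2 uk≢0))
              (∈⇒≤∑ᴸ (chargeTo k) u∈edges)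
    ... | u∈edges , uk≢0 | no ¬leaf
      with ∃-other _≟ᵥ_ (edgesAt-unique k) (≤∧≢⇒< (∈⇒0<length u∈) (¬leaf ∘ sym)) u
    ...   | v , v∈ , v≢u with edgesAt⁻ v∈
    ...     | v∈edges , vk≢0 =
      ≤-trans (+-mono-≤ (charge-≥1 _ uk≢0) (charge-≥1 _ vk≢0))
              (∈₂⇒≤∑ᴸ (chargeTo k) u∈edges v∈edges (v≢u ∘ sym))

  leaf-edgesAt-≡ : ∀ {k u v} → Leaf k → u ∈ edgesAt k → v ∈ edgesAt k → u ≡ v
  leaf-edgesAt-≡ = length≡1⇒≡

  pair-below-leaf : ∀ {a k l u} → Leaf k → u ∈ edgesAt k → a ∈ sig → pair k l ≤ᶜ a → pair k l ≡ u
  pair-below-leaf leaf u∈ a∈ p≤a = leaf-edgesAt-≡ leaf (pair-∈-edgesAt (pair-below-∈σ a∈ p≤a)) u∈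

  leaves-absorb : ∀ {i j a} → Leaf i → Leaf j → i ≢ j → pair i j ∈ sig →
                  a ∈ sig → lookup a i ≢ 0 → a ≡ pair i j
  leaves-absorb {i} {j} {a} leaf-i leaf-j i≢j c∈ a∈ ai≢0 =
    decidable-stable (a ≟ᵥ pair i j) λ a≢c →
      let (p , cp<ap) = ≤ᶜ∧≢⇒∃< c≤a (a≢c ∘ sym) in no-excess p cp<ap
    where
    c∈i : pair i j ∈ edgesAt i
    c∈i = pair-∈-edgesAt c∈

    c∈j : pair i j ∈ edgesAt j
    c∈j = subst (_∈ edgesAt j) (pair-comm j i) (pair-∈-edgesAt (subst (_∈ sig) (pair-comm i j) c∈))

    c≤a : pair i j ≤ᶜ a
    c≤a with ∃pair-below a∈ ai≢0
    ... | l , p≤a = subst (_≤ᶜ a) (pair-below-leaf leaf-i c∈i a∈ p≤a) p≤a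

    no-excess : ∀ p → ¬ (lookup (pair i j) p < lookup a p)
    no-excess p cp<ap with p ≟ᶠ i | p ≟ᶠ j
    ... | yes refl | _ =
      pair-diag≢pair i≢j (pair-below-leaf leaf-i c∈i a∈
        (pair-diag-≤ᶜ {a = a} (subst (_< lookup a p) (lookup-pair-fst i≢j) cp<ap)))
    ... | no _ | yes refl =
      pair-diag≢pair (i≢j ∘ sym) (trans (pair-below-leaf leaf-j c∈j a∈
        (pair-diag-≤ᶜ {a = a} (subst (_< lookup a p) (lookup-pair-snd i≢j) cp<ap))) (pair-comm i j))
    ... | no p≢i | no p≢j =
      pair≢pair p≢i p≢j (pair-below-leaf leaf-i c∈i a∈
        (pair-≤ᶜ {a = a} (p≢i ∘ sym) (n≢0⇒n>0 ai≢0) (subst (_< lookup a p) (lookup-pair-≢ p≢i p≢j) cp<ap)))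

  Isolated : Fin x × Fin x → Set
  Isolated (i , j) = i F.< j × pair i j ∈ sig × Leaf i × Leaf j

  isolated? : ∀ p → Dec (Isolated p)
  isolated? (i , j) = i F.<? j ×-dec (pair i j ∈? sig ×-dec (leaf? i ×-dec leaf? j))

  allPairs : List (Fin x × Fin x)
  allPairs = cartesianProduct (allFin x) (allFin x)

  isolated : List (Fin x × Fin x)
  isolated = filter isolated? allPairs

  isolated-unique : Unique isolated
  isolated-unique =
    Unique.filter⁺ isolated? (Unique.cartesianProduct⁺ (Unique.allFin⁺ x) (Unique.allFin⁺ x))

  isolated⇒σ₂-component : ∀ i j → (i , j) ∈ isolated → i F.< j × Sigma2Component sig i j
  isolated⇒σ₂-component i j ij∈
    with proj₂ (∈-filter⁻ isolated? {xs = allPairs} ij∈)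
  ... | i<j , c∈ , leaf-i , leaf-j = i<j , c∈ , λ a a∈ a≢c →
    decidable-stable (lookup a i ≟ 0) (a≢c ∘ leaves-absorb leaf-i leaf-j i≢j c∈ a∈) ,
    decidable-stable (lookup a j ≟ 0) (λ aj≢0 → a≢c (trans
      (leaves-absorb leaf-j leaf-i (i≢j ∘ sym) (subst (_∈ sig) (pair-comm i j) c∈) a∈ aj≢0)
      (pair-comm j i)))
    where i≢j = FinP.<⇒≢ i<j

  isolatedEdges : List (Node x)
  isolatedEdges = map (λ (i , j) → pair i j) isolated

  isolatedEdge? : ∀ a → Dec (a ∈ isolatedEdges)
  isolatedEdge? a = a ∈? isolatedEdges

  sent : ∀ {a} → a ∈ edges → ∑[ k < x ] chargeTo k a ≤ 3 + 𝟙 (isolatedEdge? a)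
  sent {a} a∈ with ∈-filter⁻ (λ a → size a ≟ 2) {xs = sig} a∈
  ... | a∈σ , size-a≡2 with size≡2 a size-a≡2
  ...   | inj₁ (i , refl) = ≤-trans (≤-reflexive (∑-charge-pair-diag (does ∘ leaf?) i)) (m≤m+n 3 _)
  ...   | inj₂ (i , j , i<j , refl) = begin
    ∑[ k < x ] chargeTo k (pair i j)                       ≡⟨ ∑-charge-pair (does ∘ leaf?) (FinP.<⇒≢ i<j) ⟩
    charge 1 (does (leaf? i)) + charge 1 (does (leaf? j)) ≤⟨ charge-pair≤ (leaf? i) (leaf? j) both-leaves ⟩
    3 + 𝟙 (isolatedEdge? (pair i j))                       ∎
    where
    open ≤-Reasoning
    both-leaves : Leaf i → Leaf j → 1 ≤ 𝟙 (isolatedEdge? (pair i j))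
    both-leaves leaf-i leaf-j = 𝟙-yes (isolatedEdge? _) (∈-map⁺ _
      (∈-filter⁺ isolated? (∈-cartesianProduct⁺ (∈-allFin i) (∈-allFin j)) (i<j , a∈σ , leaf-i , leaf-j)))

  isolated-count : ∑ᴸ edges (𝟙 ∘ isolatedEdge?) ≤ length isolated
  isolated-count = subst (∑ᴸ edges (𝟙 ∘ isolatedEdge?) ≤_) (length-map _ isolated)
                         (∑ᴸ-𝟙≤length isolatedEdge? edges-unique (λ a∈ → a∈))

  charging-bound : 2 * x ≤ length isolated + 3 * length sig
  charging-bound = begin
    2 * x                                    ≡⟨ trans (*-comm 2 x) (sym (∑-const x 2)) ⟩
    ∑[ k < x ] 2                             ≤⟨ ∑-mono-≤ received ⟩
    ∑[ k < x ] ∑ᴸ edges (chargeTo k)         ≡⟨ ∑-∑ᴸ-comm edges chargeTo ⟩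
    ∑ᴸ edges (λ a → ∑[ k < x ] chargeTo k a) ≤⟨ ∑ᴸ-mono-≤ edges sent ⟩
    ∑ᴸ edges (λ a → 3 + #iso a)              ≡⟨ ∑ᴸ-distrib-+ edges (λ _ → 3) #iso ⟩
    ∑ᴸ edges (λ _ → 3) + ∑ᴸ edges #iso       ≡⟨ cong (_+ ∑ᴸ edges #iso) (∑ᴸ-const edges 3) ⟩
    length edges * 3 + ∑ᴸ edges #iso         ≤⟨ +-mono-≤ (*-monoˡ-≤ 3 (length-filter _ sig)) isolated-count ⟩
    length sig * 3 + length isolated         ≡⟨ +-comm (length sig * 3) _ ⟩
    length isolated + length sig * 3         ≡⟨ cong (length isolated +_) (*-comm (length sig) 3) ⟩
    length isolated + 3 * length sig         ∎
    where
    open ≤-Reasoning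
    #iso : Node x → ℕ
    #iso = 𝟙 ∘ isolatedEdge?

  reducible : 2 ≤ length sig → 0 < length isolated → Reducible sig
  reducible 2≤m 0<n with 0<length⇒∈ {xs = isolated} 0<n
  ... | (i , j) , ij∈ with ∃-other _≟ᵥ_ (proj₁ sk) 2≤m (pair i j)
  ...   | a , a∈ , a≢c with ≢zeroNode⇒∃≢0 (σ∉μ a∈ ∘ inj₁)
  ...     | k , ak≢0 = σ₂-component⇒Reducible (proj₂ (isolated⇒σ₂-component i j ij∈)) a∈ a≢c ak≢0

density⇒2≤m : ∀ x m → x < 2 * m → 3 * m < 2 * x → 2 ≤ m
density⇒2≤m x             (suc (suc m)) _              _              = s≤s (s≤s z≤n)
density⇒2≤m (suc (suc x)) (suc zero)    (s≤s (s≤s ())) _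
density⇒2≤m (suc zero)    (suc zero)    _              (s≤s (s≤s ()))

density⇒0<n : ∀ x m n → 2 * x ≤ n + 3 * m → 3 * m < 2 * x → 0 < n
density⇒0<n x m zero    2x≤3m 3m<2x = contradiction (<-≤-trans 3m<2x 2x≤3m) (<-irrefl refl)
density⇒0<n x m (suc n) _     _     = s≤s z≤n

proposition2 : (x : ℕ) → 1 ≤ x → (lam sig : List (Node x)) →
    IsFD lam → ContainsMu lam → IsSkew lam sig → Strict sig →
    x < 2 * length sig → 3 * length sig < 2 * x →
    Reducible sig ×
    Σ (List (Fin x × Fin x)) (λ ps → Unique ps ×
      (∀ i j → (i , j) ∈ ps → i F.< j × Sigma2Component sig i j) ×
      2 * x ≤ length ps + 3 * length sig)
proposition2 x _ lam sig fd _ sk strict x<2m 3m<2x =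
  reducible (density⇒2≤m x (length sig) x<2m 3m<2x)
            (density⇒0<n x (length sig) (length isolated) charging-bound 3m<2x) ,
  isolated , isolated-unique , isolated⇒σ₂-component , charging-bound
  where open Discharging fd sk strict
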